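{- For every path $P_n$ on $n\geq 4$ vertices, $$w_2(P_n)=w_2(P_{n-1})+w_2(P_{n-2}),$$ where $w_2(P_3)=w_2(P_2)=1$.
   Context: For a graph $G$, $w_2(G)$ denotes the number of unordered partitions of $V(G)$ into two nonempty dominating sets (a dominating set $S$ being one such that every vertex outside $S$ has a neighbor in $S$); equivalently, the number of weak 2-colorings of $G$ (every non-isolated vertex has a neighbor of a different color) counted up to interchanging the two colors. $P_n$ is the path on $n$ vertices. -}

module Defs where

open import Data.Nat using (ℕ; zero; suc; _/_)
open import Data.Nat.Properties using (_≟_)
open import Data.Fin using (Fin; toℕ)
open import Data.Fin.Properties using (all?; any?)
open import Data.Bool using (Bool; true; false; not; T)
open import Data.Bool.Properties using (T?)
open import Data.Vec using (Vec; []; _∷_; lookup)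
open import Data.List using (List; []; _∷_; map; _++_; filter; length)
open import Data.Product using (Σ; _×_; _,_; ∃)
open import Data.Sum using (_⊎_)
open import Relation.Nullary using (Dec; yes; no; ¬_)
open import Relation.Nullary.Decidable using (_⊎-dec_; _×-dec_)
open import Relation.Binary.PropositionalEquality using (_≡_)

record Graph (n : ℕ) : Set₁ where
  field
    Adj     : Fin n → Fin n → Set
    adj?    : ∀ u v → Dec (Adj u v)
    sym     : ∀ {u v} → Adj u v → Adj v u
    irrefl  : ∀ {u} → ¬ Adj u u
open Graph public

Subset : ℕ → Set
Subset n = Vec Bool n

_∈_ : ∀ {n} → Fin n → Subset n → Set
v ∈ S = T (lookup S v)

∈? : ∀ {n} (v : Fin n) (S : Subset n) → Dec (v ∈ S)
∈? v S = T? (lookup S v)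

complement : ∀ {n} → Subset n → Subset n
complement [] = []
complement (b ∷ S) = not b ∷ complement S

Dominating : ∀ {n} → Graph n → Subset n → Set
Dominating {n} G S = ∀ v → v ∈ S ⊎ ∃ λ u → Adj G u v × u ∈ S

dominating? : ∀ {n} (G : Graph n) (S : Subset n) → Dec (Dominating G S)
dominating? G S = all? λ v → ∈? v S ⊎-dec any? λ u → adj? G u v ×-dec ∈? u S

NonEmpty : ∀ {n} → Subset n → Set
NonEmpty S = ∃ λ v → v ∈ S

nonEmpty? : ∀ {n} (S : Subset n) → Dec (NonEmpty S)
nonEmpty? S = any? λ v → ∈? v S

GoodPart : ∀ {n} → Graph n → Subset n → Set
GoodPart G S = (NonEmpty S × Dominating G S)
             × (NonEmpty (complement S) × Dominating G (complement S))

goodPart? : ∀ {n} (G : Graph n) (S : Subset n) → Dec (GoodPart G S)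
goodPart? G S = (nonEmpty? S ×-dec dominating? G S)
          ×-dec (nonEmpty? (complement S) ×-dec dominating? G (complement S))

allSubsets : (n : ℕ) → List (Subset n)
allSubsets zero = [] ∷ []
allSubsets (suc n) = map (true ∷_) (allSubsets n) ++ map (false ∷_) (allSubsets n)

-- Each unordered partition corresponds to exactly two
-- subsets S (S and its complement, which differ since both are nonempty),
-- so we count such subsets S and divide by 2.
w₂ : ∀ {n} → Graph n → ℕ
w₂ {n} G = length (filter (goodPart? G) (allSubsets n)) / 2

PathAdj : ∀ {n} → Fin n → Fin n → Set
PathAdj i j = suc (toℕ i) ≡ toℕ j ⊎ suc (toℕ j) ≡ toℕ i

P : (n : ℕ) → Graph n
P n = record
  { Adj = PathAdj
  ; adj? = λ i j → (suc (toℕ i) ≟ toℕ j) ⊎-dec (suc (toℕ j) ≟ toℕ i)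
  ; sym = λ { (Data.Sum.inj₁ e) → Data.Sum.inj₂ e ; (Data.Sum.inj₂ e) → Data.Sum.inj₁ e }
  ; irrefl = irr
  }
  where
  open import Data.Nat.Properties using (1+n≢n)
  irr : ∀ {u : Fin n} → ¬ PathAdj u u
  irr {u} (Data.Sum.inj₁ e) = 1+n≢n e
  irr {u} (Data.Sum.inj₂ e) = 1+n≢n e

{-# OPTIONS --safe #-}
-- A partition {S, V ∖ S} into two nonempty dominating sets is the same thing
-- as a 2-colouring in which every vertex has a neighbour of the other colour.
-- On a path this condition is local and can be checked from left to right by
-- an automaton whose state records whether the current vertex already has
-- such a neighbour on its left.  Counting the colourings of n further vertices
-- accepted from each state gives F(n+1) and F(n), so P_{n+1} has 2 F(n) such
-- colourings; each unordered partition is counted twice, whence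
-- w₂(P_{n+1}) = F(n) and the recurrence is Fibonacci's.
module Submission where

open import Defs
open import Data.Nat using (ℕ; _≤_; _∸_)
open import Data.Product using (_×_)
open import Relation.Binary.PropositionalEquality using (_≡_)

open import Data.Nat using (zero; suc; _+_; _*_; _/_; s≤s)
open import Data.Nat.Properties using (+-comm; +-identityʳ; *-suc; *-identityʳ; suc-injective)
open import Data.Nat.DivMod using (m*n/n≡m)
open import Data.Fin using (Fin) renaming (zero to fzero; suc to fsuc)
open import Data.Bool using (Bool; true; false; not; T; _∧_; _∨_; _xor_)
open import Data.Bool.Properties
  using (T?; T-≡; T-not-≡; T-∧; T-∨; ¬-not; not-¬; not-involutive)
  renaming (_≟_ to _≟ᵇ_)
open import Data.Empty using (⊥-elim)
open import Data.Unit using (tt)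
open import Data.Sum using (_⊎_; inj₁; inj₂)
import Data.Sum as Sum
open import Data.Product using (_,_; proj₂; ∃)
open import Data.Product.Function.NonDependent.Propositional using (_×-⇔_)
open import Data.Vec using (Vec; []; _∷_; lookup)
open import Data.List using ([]; _∷_; map; _++_; filter; length)
open import Data.List.Properties using (filter-++; filter-≐; filter-none; length-++)
open import Data.List.Relation.Unary.All using (universal)
open import Function using (_∘_; _⇔_; mk⇔; Equivalence)
import Function.Properties.Equivalence as ⇔
open import Relation.Nullary using (yes; no; ¬_; does; contradiction)
open import Relation.Unary using (Pred; Decidable; _≐_)
open import Relation.Binary.PropositionalEquality
  using (_≢_; refl; trans; cong; cong₂; subst; ≢-sym; module ≡-Reasoning)
  renaming (sym to ≡-sym)

open Equivalence using (to; from)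

T-xor : ∀ {x y} → T (x xor y) ⇔ x ≢ y
T-xor {true}  {true}  = mk⇔ (λ ()) (λ x≢x → x≢x refl)
T-xor {true}  {false} = mk⇔ (λ _ ()) (λ _ → tt)
T-xor {false} {true}  = mk⇔ (λ _ ()) (λ _ → tt)
T-xor {false} {false} = mk⇔ (λ ()) (λ x≢x → x≢x refl)

≢-≢⇒≡ : ∀ {x y z : Bool} → x ≢ y → y ≢ z → x ≡ z
≢-≢⇒≡ {z = z} x≢y y≢z =
  trans (¬-not x≢y) (trans (cong not (¬-not y≢z)) (not-involutive z))

colourClass : ∀ {n} → Bool → Subset n → Subset n
colourClass true  S = S
colourClass false S = complement S

lookup-complement : ∀ {n} (S : Subset n) v → lookup (complement S) v ≡ not (lookup S v)
lookup-complement (b ∷ S) fzero    = refl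
lookup-complement (b ∷ S) (fsuc v) = lookup-complement S v

∈colourClass⇔ : ∀ {n} b (S : Subset n) v → v ∈ colourClass b S ⇔ lookup S v ≡ b
∈colourClass⇔ true  S v = T-≡
∈colourClass⇔ false S v =
  subst (λ x → T x ⇔ lookup S v ≡ false) (≡-sym (lookup-complement S v)) T-not-≡

OtherColourNeighbour : ∀ {n} → Graph n → Subset n → Fin n → Set
OtherColourNeighbour G S v = ∃ λ u → Adj G u v × lookup S u ≢ lookup S v

WeakColouring : ∀ {n} → Graph n → Subset n → Set
WeakColouring G S = ∀ v → OtherColourNeighbour G S v

dominating⇒nonEmpty : ∀ {n} (G : Graph (suc n)) S → Dominating G S → NonEmpty S
dominating⇒nonEmpty G S dom with dom fzero
... | inj₁ 0∈S           = fzero , 0∈S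
... | inj₂ (u , _ , u∈S) = u , u∈S

module _ {n} (G : Graph n) (S : Subset n) where

  goodPart⇒dominating : GoodPart G S → ∀ b → Dominating G (colourClass b S)
  goodPart⇒dominating ((_ , dom) , _) true  = dom
  goodPart⇒dominating (_ , (_ , dom)) false = dom

  goodPart⇒weakColouring : GoodPart G S → WeakColouring G S
  goodPart⇒weakColouring good v with goodPart⇒dominating good (not (lookup S v)) v
  ... | inj₁ v∈ = contradiction (to (∈colourClass⇔ _ S v) v∈) (not-¬ refl)
  ... | inj₂ (u , u~v , u∈) =
    u , u~v , λ u≡v → not-¬ refl (trans (≡-sym u≡v) (to (∈colourClass⇔ _ S u) u∈))

  weakColouring⇒dominating : WeakColouring G S → ∀ b → Dominating G (colourClass b S)
  weakColouring⇒dominating weak b v with lookup S v ≟ᵇ b | weak v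
  ... | yes v≡b | _             = inj₁ (from (∈colourClass⇔ b S v) v≡b)
  ... | no  v≢b | u , u~v , u≢v =
    inj₂ (u , u~v , from (∈colourClass⇔ b S u) (≢-≢⇒≡ u≢v v≢b))

weakColouring⇒goodPart : ∀ {n} (G : Graph (suc n)) S → WeakColouring G S → GoodPart G S
weakColouring⇒goodPart G S weak = colourClassPart true , colourClassPart false
  where
  colourClassPart : ∀ b → NonEmpty (colourClass b S) × Dominating G (colourClass b S)
  colourClassPart b = dominating⇒nonEmpty G (colourClass b S) dom , dom
    where dom = weakColouring⇒dominating G S weak b

goodPart⇔weakColouring : ∀ {n} (G : Graph (suc n)) S → GoodPart G S ⇔ WeakColouring G S
goodPart⇔weakColouring G S = mk⇔ (goodPart⇒weakColouring G S) (weakColouring⇒goodPart G S)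

pathAdj-suc⇔ : ∀ {n} {u v : Fin n} → PathAdj (fsuc u) (fsuc v) ⇔ PathAdj u v
pathAdj-suc⇔ = mk⇔ (Sum.map suc-injective suc-injective) (Sum.map (cong suc) (cong suc))

pathAdj-zero-suc : ∀ {n} {v : Fin (suc n)} → PathAdj fzero (fsuc v) → v ≡ fzero
pathAdj-zero-suc {v = fzero}  _        = refl
pathAdj-zero-suc {v = fsuc _} (inj₁ ())
pathAdj-zero-suc {v = fsuc _} (inj₂ ())

noOtherColourNeighbour-P1 : ∀ b → ¬ OtherColourNeighbour (P 1) (b ∷ []) fzero
noOtherColourNeighbour-P1 b (fzero , 0~0 , _) = irrefl (P 1) 0~0

module _ {m} (b c : Bool) (R : Vec Bool m) where

  otherColourNeighbour-head⇔ :
    OtherColourNeighbour (P (suc (suc m))) (b ∷ c ∷ R) fzero ⇔ c ≢ b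
  otherColourNeighbour-head⇔ = mk⇔ head (λ c≢b → fsuc fzero , inj₂ refl , c≢b)
    where
    head : OtherColourNeighbour (P (suc (suc m))) (b ∷ c ∷ R) fzero → c ≢ b
    head (fzero , 0~0 , _)      = ⊥-elim (irrefl (P (suc (suc m))) 0~0)
    head (fsuc fzero , _ , c≢b) = c≢b
    head (fsuc (fsuc _) , inj₁ () , _)
    head (fsuc (fsuc _) , inj₂ () , _)

  otherColourNeighbour-suc⇔ : ∀ w →
    OtherColourNeighbour (P (suc (suc m))) (b ∷ c ∷ R) (fsuc w)
    ⇔ ((w ≡ fzero × b ≢ c) ⊎ OtherColourNeighbour (P (suc m)) (c ∷ R) w)
  otherColourNeighbour-suc⇔ w = mk⇔ split join
    where
    split : OtherColourNeighbour (P (suc (suc m))) (b ∷ c ∷ R) (fsuc w)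
          → (w ≡ fzero × b ≢ c) ⊎ OtherColourNeighbour (P (suc m)) (c ∷ R) w
    split (fzero  , 0~w , b≢w) =
      let w≡0 = pathAdj-zero-suc 0~w
      in  inj₁ (w≡0 , subst (λ x → b ≢ lookup (c ∷ R) x) w≡0 b≢w)
    split (fsuc u , u~w , u≢w) = inj₂ (u , to pathAdj-suc⇔ u~w , u≢w)
    join : (w ≡ fzero × b ≢ c) ⊎ OtherColourNeighbour (P (suc m)) (c ∷ R) w
         → OtherColourNeighbour (P (suc (suc m))) (b ∷ c ∷ R) (fsuc w)
    join (inj₁ (refl , b≢c))    = fzero , inj₁ refl , b≢c
    join (inj₂ (u , u~w , u≢w)) = fsuc u , from pathAdj-suc⇔ u~w , u≢w

-- With the flag set, vertex 0 is exempt: it already has a neighbour of the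
-- other colour to its left, outside the path.
WeakColouringFrom : ∀ {n} → Bool → Subset (suc n) → Set
WeakColouringFrom s S = ∀ v → (v ≡ fzero × T s) ⊎ OtherColourNeighbour (P _) S v

weakColouring⇔weakColouringFrom-false : ∀ {n} (S : Subset (suc n))
                                      → WeakColouring (P (suc n)) S ⇔ WeakColouringFrom false S
weakColouring⇔weakColouringFrom-false S =
  mk⇔ (λ weak → inj₂ ∘ weak) (λ weak → unexempt ∘ weak)
  where
  unexempt : ∀ {v} → (v ≡ fzero × T false) ⊎ OtherColourNeighbour (P _) S v
           → OtherColourNeighbour (P _) S v
  unexempt (inj₂ other) = other

weakColouringFrom-∷ : ∀ {m} s b c (R : Vec Bool m)
                    → WeakColouringFrom s (b ∷ c ∷ R)
                    ⇔ (T (s ∨ (b xor c)) × WeakColouringFrom (b xor c) (c ∷ R))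
weakColouringFrom-∷ s b c R = mk⇔ split join
  where
  leftWitness⇔ : ∀ w → (w ≡ fzero × b ≢ c) ⇔ (w ≡ fzero × T (b xor c))
  leftWitness⇔ w = ⇔.refl ×-⇔ ⇔.sym T-xor

  split : WeakColouringFrom s (b ∷ c ∷ R)
        → T (s ∨ (b xor c)) × WeakColouringFrom (b xor c) (c ∷ R)
  split weak = from T-∨ (Sum.map proj₂ differs (weak fzero)) , tail
    where
    differs : OtherColourNeighbour (P _) (b ∷ c ∷ R) fzero → T (b xor c)
    differs = from T-xor ∘ ≢-sym ∘ to (otherColourNeighbour-head⇔ b c R)

    tail : WeakColouringFrom (b xor c) (c ∷ R)
    tail w with weak (fsuc w)
    ... | inj₁ (() , _)
    ... | inj₂ other =
      Sum.map₁ (to (leftWitness⇔ w)) (to (otherColourNeighbour-suc⇔ b c R w) other)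

  join : T (s ∨ (b xor c)) × WeakColouringFrom (b xor c) (c ∷ R)
       → WeakColouringFrom s (b ∷ c ∷ R)
  join (head , tail) fzero =
    Sum.map (refl ,_) (from (otherColourNeighbour-head⇔ b c R) ∘ ≢-sym ∘ to T-xor)
                      (to T-∨ head)
  join (head , tail) (fsuc w) =
    inj₂ (from (otherColourNeighbour-suc⇔ b c R w)
               (Sum.map₁ (from (leftWitness⇔ w)) (tail w)))

-- The flag passed on says whether the next vertex differs from the current one,
-- i.e. whether its left neighbour already has the other colour.
isWeakColouringFrom : ∀ {n} → Bool → Bool → Vec Bool n → Bool
isWeakColouringFrom s b []      = s
isWeakColouringFrom s b (c ∷ R) = (s ∨ (b xor c)) ∧ isWeakColouringFrom (b xor c) c R

weakColouringFrom⇔isWeakColouringFrom :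
  ∀ {n} s b (R : Vec Bool n) → WeakColouringFrom s (b ∷ R) ⇔ T (isWeakColouringFrom s b R)
weakColouringFrom⇔isWeakColouringFrom s b [] =
  mk⇔ (λ weak → exempt (weak fzero)) (λ { t fzero → inj₁ (refl , t) })
  where
  exempt : (fzero ≡ fzero × T s) ⊎ OtherColourNeighbour (P 1) (b ∷ []) fzero → T s
  exempt (inj₁ (_ , t)) = t
  exempt (inj₂ other)   = ⊥-elim (noOtherColourNeighbour-P1 b other)
weakColouringFrom⇔isWeakColouringFrom s b (c ∷ R) =
  ⇔.trans (weakColouringFrom-∷ s b c R)
          (⇔.trans (⇔.refl ×-⇔ weakColouringFrom⇔isWeakColouringFrom (b xor c) c R)
                   (⇔.sym T-∧))

isWeakPathColouring : ∀ {n} → Subset (suc n) → Bool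
isWeakPathColouring (b ∷ R) = isWeakColouringFrom false b R

goodPart⇔isWeakPathColouring : ∀ {n} (S : Subset (suc n))
                             → GoodPart (P (suc n)) S ⇔ T (isWeakPathColouring S)
goodPart⇔isWeakPathColouring (b ∷ R) =
  ⇔.trans (goodPart⇔weakColouring (P _) (b ∷ R))
          (⇔.trans (weakColouring⇔weakColouringFrom-false (b ∷ R))
                   (weakColouringFrom⇔isWeakColouringFrom false b R))

length-filter-map : ∀ {a b ℓ} {A : Set a} {B : Set b} {Q : Pred B ℓ}
                    (Q? : Decidable Q) (f : A → B) xs →
                    length (filter Q? (map f xs)) ≡ length (filter (Q? ∘ f) xs)
length-filter-map Q? f []       = refl
length-filter-map Q? f (x ∷ xs) with does (Q? (f x))
... | true  = cong suc (length-filter-map Q? f xs)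
... | false = length-filter-map Q? f xs

count : ∀ n → (Subset n → Bool) → ℕ
count n p = length (filter (T? ∘ p) (allSubsets n))

count-∷ : ∀ n (p : Subset (suc n) → Bool)
        → count (suc n) p ≡ count n (p ∘ (true ∷_)) + count n (p ∘ (false ∷_))
count-∷ n p = begin
  length (filter p? (map (true ∷_) A ++ map (false ∷_) A))
    ≡⟨ cong length (filter-++ p? (map (true ∷_) A) _) ⟩
  length (filter p? (map (true ∷_) A) ++ filter p? (map (false ∷_) A))
    ≡⟨ length-++ (filter p? (map (true ∷_) A)) ⟩
  length (filter p? (map (true ∷_) A)) + length (filter p? (map (false ∷_) A))
    ≡⟨ cong₂ _+_ (length-filter-map p? (true ∷_) A)
                 (length-filter-map p? (false ∷_) A) ⟩
  count n (p ∘ (true ∷_)) + count n (p ∘ (false ∷_)) ∎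
  where
  open ≡-Reasoning
  A = allSubsets n
  p? = T? ∘ p

count-false : ∀ n → count n (λ _ → false) ≡ 0
count-false n =
  cong length (filter-none (T? ∘ λ _ → false) (universal (λ _ ()) (allSubsets n)))

fib : ℕ → ℕ
fib 0             = 0
fib 1             = 1
fib (suc (suc n)) = fib (suc n) + fib n

count-isWeakColouringFrom-true  : ∀ n b → count n (isWeakColouringFrom true b) ≡ fib (suc n)
count-isWeakColouringFrom-false : ∀ n b → count n (isWeakColouringFrom false b) ≡ fib n

count-isWeakColouringFrom-true zero    b     = refl
count-isWeakColouringFrom-true (suc n) true  = begin
  count (suc n) (isWeakColouringFrom true true)
    ≡⟨ count-∷ n (isWeakColouringFrom true true) ⟩
  count n (isWeakColouringFrom false true) + count n (isWeakColouringFrom true false)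
    ≡⟨ cong₂ _+_ (count-isWeakColouringFrom-false n true)
                 (count-isWeakColouringFrom-true n false) ⟩
  fib n + fib (suc n)
    ≡⟨ +-comm (fib n) (fib (suc n)) ⟩
  fib (suc n) + fib n ∎
  where open ≡-Reasoning
count-isWeakColouringFrom-true (suc n) false =
  trans (count-∷ n (isWeakColouringFrom true false))
        (cong₂ _+_ (count-isWeakColouringFrom-true n true)
                   (count-isWeakColouringFrom-false n false))

count-isWeakColouringFrom-false zero    b     = refl
count-isWeakColouringFrom-false (suc n) true  =
  trans (count-∷ n (isWeakColouringFrom false true))
        (cong₂ _+_ (count-false n) (count-isWeakColouringFrom-true n false))
count-isWeakColouringFrom-false (suc n) false = begin
  count (suc n) (isWeakColouringFrom false false)
    ≡⟨ count-∷ n (isWeakColouringFrom false false) ⟩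
  count n (isWeakColouringFrom true true) + count n (λ _ → false)
    ≡⟨ cong₂ _+_ (count-isWeakColouringFrom-true n true) (count-false n) ⟩
  fib (suc n) + 0
    ≡⟨ +-identityʳ (fib (suc n)) ⟩
  fib (suc n) ∎
  where open ≡-Reasoning

double/2 : ∀ m → (m + m) / 2 ≡ m
double/2 m = trans (cong (_/ 2) m+m≡m*2) (m*n/n≡m m 2)
  where
  m+m≡m*2 : m + m ≡ m * 2
  m+m≡m*2 = ≡-sym (trans (*-suc m 1) (cong (m +_) (*-identityʳ m)))

count-isWeakPathColouring : ∀ n → count (suc n) isWeakPathColouring ≡ fib n + fib n
count-isWeakPathColouring n =
  trans (count-∷ n isWeakPathColouring)
        (cong₂ _+_ (count-isWeakColouringFrom-false n true)
                   (count-isWeakColouringFrom-false n false))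

w₂-path : ∀ n → w₂ (P (suc n)) ≡ fib n
w₂-path n = begin
  w₂ (P (suc n))
    ≡⟨ cong (λ xs → length xs / 2) (filter-≐ _ _ good≐weak (allSubsets (suc n))) ⟩
  count (suc n) isWeakPathColouring / 2
    ≡⟨ cong (_/ 2) (count-isWeakPathColouring n) ⟩
  (fib n + fib n) / 2
    ≡⟨ double/2 (fib n) ⟩
  fib n ∎
  where
  open ≡-Reasoning
  good≐weak : GoodPart (P (suc n)) ≐ (T ∘ isWeakPathColouring)
  good≐weak = (λ {S} → to (goodPart⇔isWeakPathColouring S))
            , (λ {S} → from (goodPart⇔isWeakPathColouring S))

mainTheorem5 : (w₂ (P 3) ≡ 1 × w₂ (P 2) ≡ 1)
    × (∀ (n : ℕ) → 4 ≤ n → w₂ (P n) ≡ w₂ (P (n ∸ 1)) Data.Nat.+ w₂ (P (n ∸ 2)))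
mainTheorem5 = (w₂-path 2 , w₂-path 1) , recurrence
  where
  open ≡-Reasoning
  recurrence : ∀ n → 4 ≤ n → w₂ (P n) ≡ w₂ (P (n ∸ 1)) + w₂ (P (n ∸ 2))
  recurrence _ (s≤s (s≤s (s≤s (s≤s {n = k} _)))) = begin
    w₂ (P (4 + k))                 ≡⟨ w₂-path (3 + k) ⟩
    fib (2 + k) + fib (1 + k)      ≡⟨ cong₂ _+_ (w₂-path (2 + k)) (w₂-path (1 + k)) ⟨
    w₂ (P (3 + k)) + w₂ (P (2 + k)) ∎
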